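{- Let $P$ be a poset, $1\leq\alpha,\beta<\omega$ and $n\in\omega$. Then $P\models\psi_{\alpha\beta n}$ if and only if for all $p,q\in P$ with $p\not\leq q$, $\exists$ has an $n$-strategy for the $(\alpha+1,\beta+1)$-game on $P$ with starting position $(\{p\},\{q\})$.
   Context: The $(\alpha,\beta)$-game on $P$ with starting position $(U_0,V)$ ($U_0,V\subseteq P$) is played by $\forall$ and $\exists$ in rounds $0,1,2,\dots$; a set $U$ starts as $U_0$. $\forall$ wins in round $n$ if $U\cap V\neq\emptyset$ at the beginning of round $n$. In each round $\forall$ makes one of the moves: (1) pick $b\in P$ with $b\geq a$ for some $a\in U$; $\exists$ must add $b$ to $U$. (2) pick $A\subseteq U$ with $|A|<\alpha$ such that $\bigwedge A$ exists in $P$; $\exists$ must add $\bigwedge A$ to $U$. (3) pick $B\subseteq P$ with $|B|<\beta$ such that $\bigvee B$ exists in $P$ and lies in $U$; $\exists$ must choose some $b\in B$ and add it to $U$. $\exists$ has an $n$-strategy if she can guarantee that $\forall$ does not win in any round $\leq n$. Formulas in the signature $\{\leq\}$; for an assignment $v$ write $v[\vec{x}_k]=\{v(x_1),\dots,v(x_k)\}$. For $1\leq k<\omega$: $J_k(\vec{x}_k,y)$ holds iff $v(y)=\bigvee v[\vec{x}_k]$, $M_k(\vec{x}_k,y)$ holds iff $v(y)=\bigwedge v[\vec{x}_k]$; $C_k(\vec{x}_k,y)$ is $\bigvee_{i=1}^k y=x_i$ and $D_k=\neg C_k$; $C_{km}(\vec{x}_k,\vec{y}_m)$ holds iff $v[\vec{y}_m]\subseteq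 v[\vec{x}_k]$. Put $\sigma_k(\vec{x}_k,c)=\exists z(C_k(\vec{x}_k,z)\wedge z\leq c)$, $\tau_{kr}(\vec{x}_k,\vec{a}_r,c)=C_{kr}(\vec{x}_k,\vec{a}_r)\wedge M_r(\vec{a}_r,c)$, $\rho_{ks}(\vec{x}_k,\vec{b}_s)=\exists z(C_k(\vec{x}_k,z)\wedge J_s(\vec{b}_s,z))$. Recursively $\phi_{krs0}(\vec{x}_k,y)=D_k(\vec{x}_k,y)$ and $\phi_{krs(n+1)}(\vec{x}_k,y)=\forall\vec{a}_r\forall\vec{b}_s\forall c\Big(\big(\sigma_k(\vec{x}_k,c)\rightarrow\phi_{(k+1)rsn}(\vec{x}_k,c,y)\big)\wedge\big(\tau_{kr}(\vec{x}_k,\vec{a}_r,c)\rightarrow\phi_{(k+1)rsn}(\vec{x}_k,c,y)\big)\wedge\big(\rho_{ks}(\vec{x}_k,\vec{b}_s)\rightarrow\bigvee_{i=1}^s\phi_{(k+1)rsn}(\vec{x}_k,b_i,y)\big)\Big)$. Finally $\psi_{rsn}=\forall x\forall y(\neg(x\leq y)\rightarrow\phi_{1rsn}(x,y))$. -}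

module Defs where

open import Level using (0ℓ)
open import Data.Nat using (ℕ; zero; suc; _<_)
open import Data.Fin using (Fin; fromℕ)
open import Data.Product using (Σ; _×_; _,_)
open import Data.Sum using (_⊎_)
open import Data.Empty using (⊥)
open import Data.Vec.Functional using (Vector; insertAt)
open import Relation.Nullary using (¬_)
open import Relation.Binary.PropositionalEquality using (_≡_)

module _ {P : Set} (_≤_ : P → P → Set) where

  image : {k : ℕ} → Vector P k → P → Set
  image {k} x z = Σ (Fin k) λ i → x i ≡ z

  IsSup : (P → Set) → P → Set
  IsSup S y = ((z : P) → S z → z ≤ y) × ((u : P) → ((z : P) → S z → z ≤ u) → y ≤ u)

  IsInf : (P → Set) → P → Set
  IsInf S y = ((z : P) → S z → y ≤ z) × ((u : P) → ((z : P) → S z → u ≤ z) → u ≤ y)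

  J : {k : ℕ} → Vector P k → P → Set
  J x y = IsSup (image x) y

  M : {k : ℕ} → Vector P k → P → Set
  M x y = IsInf (image x) y

  C : {k : ℕ} → Vector P k → P → Set
  C {k} x y = Σ (Fin k) λ i → y ≡ x i

  D : {k : ℕ} → Vector P k → P → Set
  D x y = ¬ C x y

  Ckm : {k m : ℕ} → Vector P k → Vector P m → Set
  Ckm {k} {m} x y = (j : Fin m) → C x (y j)

  σ : {k : ℕ} → Vector P k → P → Set
  σ x c = Σ P λ z → C x z × (z ≤ c)

  τ : {k r : ℕ} → Vector P k → Vector P r → P → Set
  τ x a c = Ckm x a × M a c

  ρ : {k s : ℕ} → Vector P k → Vector P s → Set
  ρ x b = Σ P λ z → C x z × J b z

  snoc : {k : ℕ} → Vector P k → P → Vector P (suc k)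
  snoc {k} x c = insertAt x (fromℕ k) c

  φ : (r s n : ℕ) {k : ℕ} → Vector P k → P → Set
  φ r s zero x y = D x y
  φ r s (suc n) x y =
    (a : Vector P r) (b : Vector P s) (c : P) →
      (σ x c → φ r s n (snoc x c) y)
      × (τ x a c → φ r s n (snoc x c) y)
      × (ρ x b → Σ (Fin s) λ i → φ r s n (snoc x (b i)) y)

  ψ : (r s n : ℕ) → Set
  ψ r s n = (x y : P) → ¬ (x ≤ y) → φ r s n {1} (λ _ → x) y

  _∪｛_｝ : (P → Set) → P → (P → Set)
  (U ∪｛ b ｝) z = U z ⊎ (z ≡ b)

  Disjoint : (P → Set) → (P → Set) → Set
  Disjoint U V = (z : P) → U z → V z → ⊥

  -- NStrategy α β V n U : ∃ has an n-strategy in the (α,β)-game from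
  -- the position (U,V), i.e. she can ensure that U ∩ V = ∅ at the
  -- beginning of each of the rounds 0,...,n.
  NStrategy : (α β : ℕ) (V : P → Set) (n : ℕ) (U : P → Set) → Set
  NStrategy α β V zero U = Disjoint U V
  NStrategy α β V (suc n) U =
    Disjoint U V
    × ((a b : P) → U a → a ≤ b → NStrategy α β V n (U ∪｛ b ｝))
    × ((m : ℕ) → m < α → (A : Vector P m) → ((i : Fin m) → U (A i)) →
         (w : P) → IsInf (image A) w → NStrategy α β V n (U ∪｛ w ｝))
    × ((m : ℕ) → m < β → (B : Vector P m) → (w : P) → IsSup (image B) w → U w →
         Σ (Fin m) λ i → NStrategy α β V n (U ∪｛ B i ｝))

module Submission where

-- A finite tuple x of elements "enumerates" a position U of the game
-- when its entries are exactly the elements of U.  The three quantified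
-- clauses of φ_{krs(n+1)}(x,y) (σ, τ, ρ) are then literally ∀'s moves (1),
-- (2), (3) played in the position enumerated by x, and appending the new
-- element c to x enumerates U ∪ {c}.  Hence, by induction on n, for every
-- enumeration x of U:
--   * an n-strategy for ∃ from (U,{y}) yields φ_{krsn}(x,y)   (strategy⇒φ);
--   * φ_{krsn}(x,y) yields an n-strategy from (U,{y})         (φ⇒strategy).
-- The second direction has two extra points: ∀ may pick sets of size < r
-- (resp. < s) that are strictly smaller than the tuples quantified in φ, so
-- such sets are padded by repeating entries (which changes neither infima
-- nor suprema); and the empty meet/join are handled separately, which is
-- where α, β ≥ 1 and the reflexivity of ≤ are used.  The theorem is the
-- case U = {p}, enumerated by the 1-tuple (p).

open import Defs
open import Data.Nat using (ℕ; zero; suc; _≤_; _<_; z≤n; s≤s)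
open import Data.Nat.Properties using (n<1+n)
open import Data.Fin using (Fin; fromℕ; inject₁) renaming (zero to fzero; suc to fsuc)
open import Data.Product using (Σ; _×_; _,_; proj₁; proj₂)
open import Data.Sum using (_⊎_; inj₁; inj₂)
open import Data.Empty using (⊥-elim)
open import Data.Vec.Functional using (Vector; tail)
open import Relation.Binary.Definitions using (Reflexive)
open import Relation.Binary.Structures using (IsPartialOrder)
open import Relation.Binary.PropositionalEquality using (_≡_; refl; sym; trans; cong; subst)
open import Relation.Nullary using (¬_)
open import Function.Bundles using (_⇔_; mk⇔)

module _ {P : Set} (_⊑_ : P → P → Set) where

  snoc-last : {k : ℕ} (x : Vector P k) (c : P) → snoc _⊑_ x c (fromℕ k) ≡ c
  snoc-last {zero} x c = refl
  snoc-last {suc k} x c = snoc-last (tail x) c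

  snoc-inject₁ : {k : ℕ} (x : Vector P k) (c : P) (i : Fin k) →
    snoc _⊑_ x c (inject₁ i) ≡ x i
  snoc-inject₁ {suc k} x c fzero = refl
  snoc-inject₁ {suc k} x c (fsuc i) = snoc-inject₁ (tail x) c i

  snoc-view : {k : ℕ} (x : Vector P k) (c : P) (j : Fin (suc k)) →
    C _⊑_ x (snoc _⊑_ x c j) ⊎ (snoc _⊑_ x c j ≡ c)
  snoc-view {zero} x c fzero = inj₂ refl
  snoc-view {suc k} x c fzero = inj₁ (fzero , refl)
  snoc-view {suc k} x c (fsuc j) with snoc-view (tail x) c j
  ... | inj₁ (i , e) = inj₁ (fsuc i , e)
  ... | inj₂ e = inj₂ e

  -- The tuple x enumerates the set U: U = v[x].  This is the invariant
  -- linking the positions of the game to the free variables of φ.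
  Enumerates : {k : ℕ} → (P → Set) → Vector P k → Set
  Enumerates U x = (z : P) → (U z → C _⊑_ x z) × (C _⊑_ x z → U z)

  enumerates-snoc : {k : ℕ} {U : P → Set} {x : Vector P k} (c : P) →
    Enumerates U x → Enumerates (_∪｛_｝ _⊑_ U c) (snoc _⊑_ x c)
  enumerates-snoc {k} {U} {x} c enum z = listed , contained
    where
    listed : _∪｛_｝ _⊑_ U c z → C _⊑_ (snoc _⊑_ x c) z
    listed (inj₁ u) =
      let (i , e) = proj₁ (enum z) u in inject₁ i , trans e (sym (snoc-inject₁ x c i))
    listed (inj₂ e) = fromℕ k , trans e (sym (snoc-last x c))
    contained : C _⊑_ (snoc _⊑_ x c) z → _∪｛_｝ _⊑_ U c z
    contained (j , e) with snoc-view x c j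
    ... | inj₁ (i , e') = inj₁ (proj₂ (enum z) (i , trans e e'))
    ... | inj₂ e' = inj₂ (trans e e')

  IsInf-cong : {S T : P → Set} {w : P} → ((z : P) → S z → T z) → ((z : P) → T z → S z) →
    IsInf _⊑_ S w → IsInf _⊑_ T w
  IsInf-cong S⊆T T⊆S (lower , greatest) =
    (λ z t → lower z (T⊆S z t)) , (λ u below → greatest u (λ z s → below z (S⊆T z s)))

  IsSup-cong : {S T : P → Set} {w : P} → ((z : P) → S z → T z) → ((z : P) → T z → S z) →
    IsSup _⊑_ S w → IsSup _⊑_ T w
  IsSup-cong S⊆T T⊆S (upper , least) =
    (λ z t → upper z (T⊆S z t)) , (λ u above → least u (λ z s → above z (S⊆T z s)))

  -- Padding a nonempty tuple of length m+1 to length a+1 (m ≤ a) by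
  -- repeating entries, without changing its set of entries.  This lets a
  -- set of size < r be fed to the quantifier ∀a⃗_r of φ.
  squash : {a : ℕ} (m : ℕ) → Fin (suc a) → Fin (suc m)
  squash zero _ = fzero
  squash (suc m) fzero = fzero
  squash {suc a} (suc m) (fsuc i) = fsuc (squash m i)

  squash-surjective : {a m : ℕ} → m ≤ a → (j : Fin (suc m)) →
    Σ (Fin (suc a)) λ i → squash m i ≡ j
  squash-surjective {m = zero} m≤a fzero = fzero , refl
  squash-surjective {m = suc m} m≤a fzero = fzero , refl
  squash-surjective {suc a} {suc m} (s≤s m≤a) (fsuc j) =
    let (i , e) = squash-surjective m≤a j in fsuc i , cong fsuc e

  pad : {m : ℕ} (a : ℕ) → Vector P (suc m) → Vector P (suc a)
  pad {m} a B i = B (squash m i)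

  pad-image⊆ : {m : ℕ} (a : ℕ) (B : Vector P (suc m)) (z : P) →
    image _⊑_ (pad a B) z → image _⊑_ B z
  pad-image⊆ a B z (i , e) = squash _ i , e

  pad-image⊇ : {a m : ℕ} → m ≤ a → (B : Vector P (suc m)) (z : P) →
    image _⊑_ B z → image _⊑_ (pad a B) z
  pad-image⊇ m≤a B z (j , e) =
    let (i , e') = squash-surjective m≤a j in i , trans (cong B e') e

  -- Strategies give formulas: each clause of φ_{n+1} is answered by the
  -- corresponding move of the game (sets of size exactly r and s suffice).
  strategy⇒φ : (r s n : ℕ) {k : ℕ} (x : Vector P k) (y : P) (U : P → Set) →
    Enumerates U x → NStrategy _⊑_ (suc r) (suc s) (λ z → z ≡ y) n U → φ _⊑_ r s n x y
  strategy⇒φ r s zero x y U enum disjoint c = disjoint y (proj₂ (enum y) c) refl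
  strategy⇒φ r s (suc n) x y U enum (_ , upward , meet , join) a b c =
    onσ , onτ , onρ
    where
    onσ : σ _⊑_ x c → φ _⊑_ r s n (snoc _⊑_ x c) y
    onσ (z , xz , z⊑c) =
      strategy⇒φ r s n _ y _ (enumerates-snoc c enum) (upward z c (proj₂ (enum z) xz) z⊑c)
    onτ : τ _⊑_ x a c → φ _⊑_ r s n (snoc _⊑_ x c) y
    onτ (a⊆x , c=⋀a) =
      strategy⇒φ r s n _ y _ (enumerates-snoc c enum)
        (meet r (n<1+n r) a (λ i → proj₂ (enum _) (a⊆x i)) c c=⋀a)
    onρ : ρ _⊑_ x b → Σ (Fin s) λ i → φ _⊑_ r s n (snoc _⊑_ x (b i)) y
    onρ (z , xz , z=⋁b) =
      let (i , strat) = join s (n<1+n s) b z z=⋁b (proj₂ (enum z) xz)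
      in i , strategy⇒φ r s n _ y _ (enumerates-snoc (b i) enum) strat

  disjoint-from-D : {k : ℕ} {U : P → Set} {x : Vector P k} {y : P} →
    Enumerates U x → D _⊑_ x y → Disjoint _⊑_ U (λ z → z ≡ y)
  disjoint-from-D {x = x} enum y∉x z u z≡y = y∉x (subst (C _⊑_ x) z≡y (proj₁ (enum z) u))

  -- In a reflexive relation φ_{krsn}(x,y) implies D_k(x,y) for k ≥ 1: the
  -- σ-clause with c = x₁ keeps the old variables, down to φ₀ = D.
  φ⇒D : Reflexive _⊑_ → (r s n : ℕ) {k : ℕ} (x : Vector P (suc k)) (y : P) →
    φ _⊑_ r s n x y → D _⊑_ x y
  φ⇒D ⊑-refl r s zero x y h = h
  φ⇒D ⊑-refl r s (suc n) x y h (i , y≡xi) =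
    φ⇒D ⊑-refl r s n (snoc _⊑_ x d) y
      (proj₁ (h (λ _ → d) (λ _ → d) d) (d , (fzero , refl) , ⊑-refl))
      (inject₁ i , trans y≡xi (sym (snoc-inject₁ x d i)))
    where
    d : P
    d = x fzero

  -- The empty meet is a
  -- top element, so it is reached by move (1) from x₁; the empty join is a
  -- bottom element, and it can never lie in U, since then y would be an
  -- upper bound of an element of U and the σ-clause would give φ_n((x,y), y),
  -- contradicting φ⇒D.
  φ⇒strategy : Reflexive _⊑_ → (a b n : ℕ) {k : ℕ} (x : Vector P (suc k)) (y : P)
    (U : P → Set) → Enumerates U x → φ _⊑_ (suc a) (suc b) n x y →
    NStrategy _⊑_ (suc (suc a)) (suc (suc b)) (λ z → z ≡ y) n U
  φ⇒strategy ⊑-refl a b zero x y U enum h = disjoint-from-D enum h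
  φ⇒strategy ⊑-refl a b (suc n) {k} x y U enum h =
    disjoint-from-D enum (φ⇒D ⊑-refl (suc a) (suc b) (suc n) x y h) , upward , meet , join
    where
    r s : ℕ
    r = suc a
    s = suc b
    d : P
    d = x fzero
    Strategy : (P → Set) → Set
    Strategy = NStrategy _⊑_ (suc r) (suc s) (λ z → z ≡ y) n
    continue : (c : P) → φ _⊑_ r s n (snoc _⊑_ x c) y → Strategy (_∪｛_｝ _⊑_ U c)
    continue c = φ⇒strategy ⊑-refl a b n (snoc _⊑_ x c) y _ (enumerates-snoc c enum)

    upward : (u c : P) → U u → u ⊑ c → Strategy (_∪｛_｝ _⊑_ U c)
    upward u c Uu u⊑c = continue c
      (proj₁ (h (λ _ → d) (λ _ → d) c) (u , proj₁ (enum u) Uu , u⊑c))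

    meet : (m : ℕ) → m < suc r → (A : Vector P m) → ((i : Fin m) → U (A i)) →
      (w : P) → IsInf _⊑_ (image _⊑_ A) w → Strategy (_∪｛_｝ _⊑_ U w)
    meet zero _ A _ w w=⋀A = upward d w (proj₂ (enum d) (fzero , refl)) (proj₂ w=⋀A d (λ _ ()))
    meet (suc m) (s≤s (s≤s m≤a)) A A⊆U w w=⋀A = continue w
      (proj₁ (proj₂ (h (pad a A) (λ _ → d) w))
        ( (λ j → proj₁ (enum _) (A⊆U (squash m j)))
        , IsInf-cong (pad-image⊇ m≤a A) (pad-image⊆ a A) w=⋀A))

    join : (m : ℕ) → m < suc s → (B : Vector P m) → (w : P) →
      IsSup _⊑_ (image _⊑_ B) w → U w →
      Σ (Fin m) λ i → Strategy (_∪｛_｝ _⊑_ U (B i))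
    join zero _ B w w=⋁B Uw = ⊥-elim
      (φ⇒D ⊑-refl r s n (snoc _⊑_ x y) y
        (proj₁ (h (λ _ → d) (λ _ → d) y) (w , proj₁ (enum w) Uw , proj₂ w=⋁B y (λ _ ())))
        (fromℕ (suc k) , sym (snoc-last x y)))
    join (suc m) (s≤s (s≤s m≤b)) B w w=⋁B Uw =
      let (i , φ-next) = proj₂ (proj₂ (h (λ _ → d) (pad b B) w))
                           (w , proj₁ (enum w) Uw , IsSup-cong (pad-image⊇ m≤b B) (pad-image⊆ b B) w=⋁B)
      in squash m i , continue (B (squash m i)) φ-next

proposition5p4 : (P : Set) (_⊑_ : P → P → Set) → IsPartialOrder _≡_ _⊑_ →
    (α β n : ℕ) → 1 ≤ α → 1 ≤ β →
    ψ _⊑_ α β n ⇔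
    ((p q : P) → ¬ (p ⊑ q) →
    NStrategy _⊑_ (suc α) (suc β) (λ z → z ≡ q) n (λ z → z ≡ p))
proposition5p4 P _⊑_ isPartialOrder (suc a) (suc b) n (s≤s z≤n) (s≤s z≤n) =
  mk⇔ (λ ψ-holds p q p⋢q → φ⇒strategy _⊑_ ⊑-refl a b n _ q _ (singleton p) (ψ-holds p q p⋢q))
      (λ strategies p q p⋢q → strategy⇒φ _⊑_ (suc a) (suc b) n _ q _ (singleton p) (strategies p q p⋢q))
  where
  open IsPartialOrder isPartialOrder using () renaming (refl to ⊑-refl)
  singleton : (p : P) → Enumerates _⊑_ (λ z → z ≡ p) (λ (_ : Fin 1) → p)
  singleton p z = (λ z≡p → fzero , z≡p) , (λ { (_ , z≡p) → z≡p })
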